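{- Let $F_1,F_2,F_3,F_4$ be finite integral domains (i.e. finite fields) with $|F_i^*|=n_i$ for $i=1,2,3,4$ and $n_1\geq n_2\geq n_3\geq n_4$, and let $R=F_1\times F_2\times F_3\times F_4$. Then $$\alpha(\Gamma(R))=n_1(n_2n_3+n_2n_4+n_3n_4+n_2+n_3)+\max\{n_1+n_1n_4,\; n_2n_3+n_2n_3n_4,\; n_1n_4+n_2n_3n_4\}.$$
   Context: $F^*=F\setminus\{0\}$. For a commutative ring $R$ with $1\neq 0$, $\Gamma(R)$ is the simple undirected graph whose vertices are the nonzero zero-divisors of $R$, two distinct vertices $x,y$ being adjacent iff $xy=0$. $\alpha(G)$ is the independence number of a graph $G$ (maximum size of a set of pairwise non-adjacent vertices). -}

module Defs where

open import Level using (Level; _⊔_)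
open import Data.Nat using (ℕ; _≤_)
open import Data.Fin using (Fin)
open import Data.Product using (Σ; ∃; _×_)
open import Data.Sum using (_⊎_)
open import Data.List using (List; length)
open import Data.List.Relation.Unary.All using (All)
open import Data.List.Relation.Unary.AllPairs using (AllPairs)
open import Relation.Nullary using (¬_)
open import Relation.Binary.PropositionalEquality using (_≡_)
open import Algebra.Bundles using (CommutativeRing)
import Algebra.Construct.DirectProduct as DP

record FiniteIntegralDomain (c ℓ : Level) : Set (Level.suc (c ⊔ ℓ)) where
  field
    ring : CommutativeRing c ℓ
  open CommutativeRing ring
  field
    nontrivial     : ¬ (1# ≈ 0#)
    noZeroDivisors : ∀ x y → x * y ≈ 0# → x ≈ 0# ⊎ y ≈ 0#
    card           : ℕ
    enum           : Fin card → Carrier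
    enum-inj       : ∀ i j → enum i ≈ enum j → i ≡ j
    enum-surj      : ∀ x → ∃ λ i → enum i ≈ x

product4 : ∀ {c ℓ} → (F₁ F₂ F₃ F₄ : FiniteIntegralDomain c ℓ) → CommutativeRing c ℓ
product4 F₁ F₂ F₃ F₄ =
  DP.commutativeRing (FiniteIntegralDomain.ring F₁)
    (DP.commutativeRing (FiniteIntegralDomain.ring F₂)
      (DP.commutativeRing (FiniteIntegralDomain.ring F₃) (FiniteIntegralDomain.ring F₄)))

module ZeroDivisorGraph {c ℓ} (R : CommutativeRing c ℓ) where
  open CommutativeRing R

  IsVertex : Carrier → Set (c ⊔ ℓ)
  IsVertex x = ¬ (x ≈ 0#) × ∃ λ y → ¬ (y ≈ 0#) × x * y ≈ 0#

  Adjacent : Carrier → Carrier → Set ℓ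
  Adjacent x y = ¬ (x ≈ y) × x * y ≈ 0#

  IsIndependent : List Carrier → Set (c ⊔ ℓ)
  IsIndependent xs =
    All IsVertex xs × AllPairs (λ x y → ¬ (x ≈ y)) xs × AllPairs (λ x y → ¬ Adjacent x y) xs

  IsIndependenceNumber : ℕ → Set (c ⊔ ℓ)
  IsIndependenceNumber N =
    (∃ λ xs → IsIndependent xs × length xs ≡ N) × (∀ xs → IsIndependent xs → length xs ≤ N)

-- An element x of R = F₁ × F₂ × F₃ × F₄ has a support S ⊆ {1,2,3,4}, the set of coordinates where
-- it is nonzero, and there are exactly ∏_{i ∈ S} nᵢ elements with support S. Since the Fᵢ are fields,
-- xy = 0 iff the supports of x and y are disjoint, so the vertices of Γ(R) are the elements of proper
-- nonempty support, and a set of vertices is independent iff their supports pairwise intersect.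
-- Such a set has elements in at most one class of each complementary pair {S, ∁S}. For n₁ ≥ n₂ ≥ n₃ ≥ n₄
-- the heavier class of the pairs {13,24}, {134,2}, {12,34}, {124,3}, {123,4} contributes
-- n₁(n₂n₃ + n₂n₄ + n₃n₄ + n₂ + n₃). The pairs {1,234} and {14,23} interact, since {1} is also
-- disjoint from {2,3}; the admissible choices give the three terms of the maximum. Each bound is
-- attained by the union of the corresponding classes.

module Submission where

open import Defs
open import Algebra.Bundles using (CommutativeRing)
open import Level using (Level)
open import Data.Bool.Base using (Bool; true; false; not; _∧_; _∨_; if_then_else_)
import Data.Bool.Properties as Bool
open import Data.Empty using (⊥-elim)
open import Data.Fin.Base as Fin using (Fin; punchIn; punchOut)
open import Data.Fin.Properties using (_≟_; injective⇒≤; nonZeroIndex; punchInᵢ≢i; punchOut-injective; punchOut-cong; punchOut-punchIn)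
open import Data.List.Base using (List; []; _∷_; _++_; length; map; concatMap; cartesianProduct; filter; lookup; tabulate; [_])
open import Data.List.Properties using (length-++; length-map; length-tabulate; map-cong; map-∘; map-id)
open import Data.List.Membership.Propositional using (_∈_; lose)
open import Data.List.Membership.Propositional.Properties
  using ( ∈-++⁺ˡ; ∈-++⁺ʳ; ∈-map⁺; ∈-map⁻; ∈-lookup; ∈-filter⁺; ∈-filter⁻; ∈-cartesianProduct⁺; ∈-cartesianProduct⁻
        ; ∈-concatMap⁺; ∈-concatMap⁻; ∈-tabulate⁺; ∈-tabulate⁻)
open import Data.List.Relation.Binary.Subset.Propositional using (_⊆_)
open import Data.List.Relation.Unary.All as All using (All; []; _∷_)
open import Data.List.Relation.Unary.AllPairs as AllPairs using (AllPairs; []; _∷_)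
import Data.List.Relation.Unary.AllPairs.Properties as AllPairs
import Data.List.Relation.Unary.All.Properties as All
open import Data.List.Relation.Binary.Disjoint.Propositional using (Disjoint)
open import Data.List.Relation.Unary.Any as Any using (here; there)
open import Data.List.Relation.Unary.Any.Properties using (lookup-index)
open import Data.List.Relation.Unary.Unique.Propositional using (Unique)
import Data.List.Relation.Unary.Unique.Propositional.Properties as Unique
open import Data.Maybe.Base using (Maybe; just; nothing; is-just)
open import Data.Maybe.Properties using (just-injective)
open import Data.Nat.Base using (ℕ; suc; _+_; _*_; _⊔_; _≤_; _≥_; >-nonZero⁻¹)
open import Data.Nat.ListAction using (sum)
open import Data.Nat.ListAction.Properties using (sum-++)
open import Data.Nat.Properties
  using ( ≤-refl; ≤-trans; ≤-reflexive; +-mono-≤; *-mono-≤; +-identityʳ; +-comm; +-assoc; *-identityʳ; *-assoc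
        ; m≤m⊔n; m≤n⊔m; ⊔-sel; module ≤-Reasoning)
open import Data.Nat.Tactic.RingSolver using (solve-∀)
open import Data.Product.Base using (_×_; _,_; proj₁; proj₂; ∃)
open import Data.Product.Properties using (≡-dec)
open import Data.Sum.Base using (_⊎_; inj₁; inj₂; reduce)
open import Function.Base using (_∘_)
open import Relation.Binary.Definitions using (DecidableEquality; Symmetric)
open import Relation.Nullary using (¬_; yes; no; contradiction)
open import Relation.Nullary.Decidable using (True; _×-dec_; ¬?; toWitness)
open import Relation.Unary using (Decidable)
open import Relation.Binary.PropositionalEquality using (_≡_; _≢_; refl; sym; trans; cong; cong₂; subst; module ≡-Reasoning)
open import Relation.Binary.PropositionalEquality.Properties using (subst-injective; subst-subst-sym)

private variable
  a b r : Level
  A : Set a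
  B : Set b

length-cartesianProduct : (xs : List A) (ys : List B) →
                          length (cartesianProduct xs ys) ≡ length xs * length ys
length-cartesianProduct []       ys = refl
length-cartesianProduct (x ∷ xs) ys = begin
  length (map (x ,_) ys ++ cartesianProduct xs ys)         ≡⟨ length-++ (map (x ,_) ys) ⟩
  length (map (x ,_) ys) + length (cartesianProduct xs ys) ≡⟨ cong₂ _+_ (length-map (x ,_) ys) (length-cartesianProduct xs ys) ⟩
  length ys + length xs * length ys                         ∎
  where open ≡-Reasoning

length-concatMap : (f : A → List B) (xs : List A) → length (concatMap f xs) ≡ sum (map (length ∘ f) xs)
length-concatMap f []       = refl
length-concatMap f (x ∷ xs) = trans (length-++ (f x)) (cong (length (f x) +_) (length-concatMap f xs))

Unique⇒lookup-injective : {xs : List A} → Unique xs → ∀ i j → lookup xs i ≡ lookup xs j → i ≡ j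
Unique⇒lookup-injective (_ ∷ _) Fin.zero Fin.zero _ = refl
Unique⇒lookup-injective (x∉xs ∷ _) Fin.zero (Fin.suc j) x≡xⱼ = ⊥-elim (All.lookup x∉xs (∈-lookup j) x≡xⱼ)
Unique⇒lookup-injective (x∉xs ∷ _) (Fin.suc i) Fin.zero xᵢ≡x = ⊥-elim (All.lookup x∉xs (∈-lookup i) (sym xᵢ≡x))
Unique⇒lookup-injective (_ ∷ u) (Fin.suc i) (Fin.suc j) eq = cong Fin.suc (Unique⇒lookup-injective u i j eq)

Unique-⊆⇒length≤ : {xs ys : List A} → Unique xs → xs ⊆ ys → length xs ≤ length ys
Unique-⊆⇒length≤ {xs = xs} {ys} u xs⊆ys = injective⇒≤ position-injective
  where
  position : Fin (length xs) → Fin (length ys)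
  position i = Any.index (xs⊆ys (∈-lookup i))

  position-injective : ∀ {i j} → position i ≡ position j → i ≡ j
  position-injective {i} {j} eq = Unique⇒lookup-injective u i j (begin
    lookup xs i                ≡⟨ lookup-index (xs⊆ys (∈-lookup i)) ⟩
    lookup ys (position i)     ≡⟨ cong (lookup ys) eq ⟩
    lookup ys (position j)     ≡⟨ lookup-index (xs⊆ys (∈-lookup j)) ⟨
    lookup xs j                ∎)
    where open ≡-Reasoning

AllPairs⇒∈-related : {R : A → A → Set r} → Symmetric R → {xs : List A} →
                     All (λ x → R x x) xs → AllPairs R xs → ∀ {x y} → x ∈ xs → y ∈ xs → R x y
AllPairs⇒∈-related sym-R (Rxx ∷ _)  _          (here refl) (here refl) = Rxx
AllPairs⇒∈-related sym-R _          (Rx ∷ _)   (here refl) (there y∈) = All.lookup Rx y∈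
AllPairs⇒∈-related sym-R _          (Ry ∷ _)   (there x∈) (here refl) = sym-R (All.lookup Ry x∈)
AllPairs⇒∈-related sym-R (_ ∷ Rxxs) (_ ∷ Rxs)  (there x∈) (there y∈) = AllPairs⇒∈-related sym-R Rxxs Rxs x∈ y∈

∈-related⇒AllPairs : {R : A → A → Set r} {xs : List A} →
                     (∀ {x y} → x ∈ xs → y ∈ xs → R x y) → AllPairs R xs
∈-related⇒AllPairs {xs = []}     _ = []
∈-related⇒AllPairs {xs = x ∷ xs} R∈ =
  All.tabulate (R∈ (here refl) ∘ there) ∷ ∈-related⇒AllPairs (λ x∈ y∈ → R∈ (there x∈) (there y∈))

+-≤-if-one-zero : ∀ {m n o} → m ≤ o → n ≤ o → m ≡ 0 ⊎ n ≡ 0 → m + n ≤ o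
+-≤-if-one-zero _   n≤o (inj₁ refl) = n≤o
+-≤-if-one-zero m≤o _   (inj₂ refl) = subst (_≤ _) (sym (+-identityʳ _)) m≤o

private
  +-≤-triangle₀ : ∀ {q r s x y z w} → q ≤ y → r ≤ z → s ≤ w → r ≡ 0 ⊎ s ≡ 0 →
                  q + (r + s) ≤ (x + z) ⊔ (w + y) ⊔ (z + y)
  +-≤-triangle₀ {q} {s = s} {x} {z = z} q≤y _ s≤w (inj₁ refl) =
    ≤-trans (≤-reflexive (+-comm q s))
            (≤-trans (+-mono-≤ s≤w q≤y) (≤-trans (m≤n⊔m (x + z) _) (m≤m⊔n _ _)))
  +-≤-triangle₀ {q} {r} q≤y r≤z _ (inj₂ refl) =
    ≤-trans (≤-reflexive (trans (cong (q +_) (+-identityʳ r)) (+-comm q r)))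
            (≤-trans (+-mono-≤ r≤z q≤y) (m≤n⊔m _ _))

+-≤-triangle : ∀ {p q r s x y z w} → p ≤ x → q ≤ y → r ≤ z → s ≤ w →
               p ≡ 0 ⊎ q ≡ 0 → r ≡ 0 ⊎ s ≡ 0 → p ≡ 0 ⊎ s ≡ 0 →
               p + q + (r + s) ≤ (x + z) ⊔ (w + y) ⊔ (z + y)
+-≤-triangle _ q≤y r≤z s≤w (inj₁ refl) rs _ = +-≤-triangle₀ q≤y r≤z s≤w rs
+-≤-triangle _ q≤y r≤z s≤w _ rs (inj₁ refl) = +-≤-triangle₀ q≤y r≤z s≤w rs
+-≤-triangle {p} {r = r} p≤x _ r≤z _ (inj₂ refl) _ (inj₂ refl) =
  ≤-trans (≤-reflexive (cong₂ _+_ (+-identityʳ p) (+-identityʳ r)))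
          (≤-trans (+-mono-≤ p≤x r≤z) (≤-trans (m≤m⊔n _ _) (m≤m⊔n _ _)))

-- Supports

,-cong₄ : {A B C D : Set} {a a′ : A} {b b′ : B} {c c′ : C} {d d′ : D} →
          a ≡ a′ → b ≡ b′ → c ≡ c′ → d ≡ d′ → (a , b , c , d) ≡ (a′ , b′ , c′ , d′)
,-cong₄ refl refl refl refl = refl

Support : Set
Support = Bool × Bool × Bool × Bool

full : Support
full = true , true , true , true

meets : Support → Support → Bool
meets (s₁ , s₂ , s₃ , s₄) (t₁ , t₂ , t₃ , t₄) = s₁ ∧ t₁ ∨ s₂ ∧ t₂ ∨ s₃ ∧ t₃ ∨ s₄ ∧ t₄

meets-sym : ∀ S T → meets S T ≡ meets T S
meets-sym (s₁ , s₂ , s₃ , s₄) (t₁ , t₂ , t₃ , t₄) =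
  cong₂ _∨_ (Bool.∧-comm s₁ t₁) (cong₂ _∨_ (Bool.∧-comm s₂ t₂)
    (cong₂ _∨_ (Bool.∧-comm s₃ t₃) (Bool.∧-comm s₄ t₄)))

∨≡true⇒ : ∀ x y → x ∨ y ≡ true → x ≡ true ⊎ y ≡ true
∨≡true⇒ true  _ _    = inj₁ refl
∨≡true⇒ false _ y≡true = inj₂ y≡true

meets≡true⇒ : ∀ S T → meets S T ≡ true →
              let (s₁ , s₂ , s₃ , s₄) = S; (t₁ , t₂ , t₃ , t₄) = T
              in s₁ ∧ t₁ ≡ true ⊎ s₂ ∧ t₂ ≡ true ⊎ s₃ ∧ t₃ ≡ true ⊎ s₄ ∧ t₄ ≡ true
meets≡true⇒ (s₁ , s₂ , s₃ , s₄) (t₁ , t₂ , t₃ , t₄) meet with ∨≡true⇒ (s₁ ∧ t₁) _ meet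
... | inj₁ m₁ = inj₁ m₁
... | inj₂ m with ∨≡true⇒ (s₂ ∧ t₂) _ m
...   | inj₁ m₂ = inj₂ (inj₁ m₂)
...   | inj₂ m′ = inj₂ (inj₂ (∨≡true⇒ (s₃ ∧ t₃) _ m′))

meets≡false⇒ : ∀ S T → meets S T ≡ false →
               let (s₁ , s₂ , s₃ , s₄) = S; (t₁ , t₂ , t₃ , t₄) = T
               in s₁ ∧ t₁ ≡ false × s₂ ∧ t₂ ≡ false × s₃ ∧ t₃ ≡ false × s₄ ∧ t₄ ≡ false
meets≡false⇒ (s₁ , s₂ , s₃ , s₄) (t₁ , t₂ , t₃ , t₄) disjoint =
  Bool.∨-conicalˡ (s₁ ∧ t₁) _ disjoint , Bool.∨-conicalˡ (s₂ ∧ t₂) _ d ,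
  Bool.∨-conicalˡ (s₃ ∧ t₃) _ d′ , Bool.∨-conicalʳ (s₃ ∧ t₃) _ d′
  where
  d  = Bool.∨-conicalʳ (s₁ ∧ t₁) _ disjoint
  d′ = Bool.∨-conicalʳ (s₂ ∧ t₂) _ d

_≟ˢ_ : DecidableEquality Support
_≟ˢ_ = ≡-dec Bool._≟_ (≡-dec Bool._≟_ (≡-dec Bool._≟_ Bool._≟_))

∁ : Support → Support
∁ (s₁ , s₂ , s₃ , s₄) = not s₁ , not s₂ , not s₃ , not s₄

∁-involutive : ∀ S → ∁ (∁ S) ≡ S
∁-involutive (s₁ , s₂ , s₃ , s₄) =
  ,-cong₄ (Bool.not-involutive s₁) (Bool.not-involutive s₂) (Bool.not-involutive s₃) (Bool.not-involutive s₄)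

meets-∁ : ∀ S → meets S (∁ S) ≡ false
meets-∁ (s₁ , s₂ , s₃ , s₄)
  rewrite Bool.∧-inverseʳ s₁ | Bool.∧-inverseʳ s₂ | Bool.∧-inverseʳ s₃ | Bool.∧-inverseʳ s₄ = refl

halfSupports : List Support
halfSupports = map (true ,_) (cartesianProduct bools (cartesianProduct bools bools))
  where bools = false ∷ true ∷ []

true-∈-halfSupports : ∀ s₂ s₃ s₄ → (true , s₂ , s₃ , s₄) ∈ halfSupports
true-∈-halfSupports s₂ s₃ s₄ =
  ∈-map⁺ (true ,_) (∈-cartesianProduct⁺ (∈-bools s₂) (∈-cartesianProduct⁺ (∈-bools s₃) (∈-bools s₄)))
  where
  ∈-bools : ∀ b → b ∈ false ∷ true ∷ []
  ∈-bools false = here refl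
  ∈-bools true  = there (here refl)

∈-halfSupports : ∀ S → S ∈ halfSupports ⊎ ∁ S ∈ halfSupports
∈-halfSupports (true  , s₂ , s₃ , s₄) = inj₁ (true-∈-halfSupports s₂ s₃ s₄)
∈-halfSupports (false , s₂ , s₃ , s₄) = inj₂ (true-∈-halfSupports (not s₂) (not s₃) (not s₄))

IsIntersectingFamily : List Support → Set
IsIntersectingFamily 𝓕 = Unique 𝓕 × All (λ S → All (λ T → meets S T ≡ true) 𝓕) 𝓕 × All (_≢ full) 𝓕

isIntersectingFamily? : Decidable IsIntersectingFamily
isIntersectingFamily? 𝓕 =
  AllPairs.allPairs? (λ S T → ¬? (S ≟ˢ T)) 𝓕
  ×-dec All.all? (λ S → All.all? (λ T → meets S T Bool.≟ true) 𝓕) 𝓕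
  ×-dec All.all? (λ S → ¬? (S ≟ˢ full)) 𝓕

-- The heavier class of five complementary pairs when n₁ ≥ n₂ ≥ n₃ ≥ n₄.
core : List Support
core = (true , false , true , false) ∷ (true , false , true , true) ∷ (true , true , false , false)
     ∷ (true , true , false , true) ∷ (true , true , true , false) ∷ []

total : (Support → ℕ) → ℕ
total a = sum (map (λ S → a S + a (∁ S)) halfSupports)

-- Codes of the elements of a product of four finite fields

scale : Bool → ℕ → ℕ → ℕ
scale true  n m = n * m
scale false _ m = m

options : (n : ℕ) → Bool → List (Maybe (Fin n))
options n true  = tabulate just
options n false = [ nothing ]

options-unique : ∀ n b → Unique (options n b)
options-unique n true  = Unique.tabulate⁺ λ { refl → refl }
options-unique n false = [] ∷ []

∈-options : ∀ {n} (m : Maybe (Fin n)) → m ∈ options n (is-just m)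
∈-options (just i) = ∈-tabulate⁺ i
∈-options nothing  = here refl

∈-options⁻ : ∀ {n} {m : Maybe (Fin n)} b → m ∈ options n b → is-just m ≡ b
∈-options⁻ {m = just _}  true  _     = refl
∈-options⁻ {m = nothing} true  m∈ with () ← proj₂ (∈-tabulate⁻ m∈)
∈-options⁻ {m = nothing} false _     = refl
∈-options⁻ {m = just _}  false (here ())

length-options : ∀ n b → length (options n b) ≡ scale b n 1
length-options n true  = trans (length-tabulate {n = n} just) (sym (*-identityʳ n))
length-options n false = refl

length-options-× : ∀ n b (xs : List A) → length (cartesianProduct (options n b) xs) ≡ scale b n (length xs)
length-options-× n true  xs =
  trans (length-cartesianProduct (options n true) xs) (cong (_* length xs) (length-tabulate {n = n} just))
length-options-× n false xs = trans (length-cartesianProduct [ nothing ] xs) (+-identityʳ (length xs))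

module Codes (n₁ n₂ n₃ n₄ : ℕ) where

  Code : Set
  Code = Maybe (Fin n₁) × Maybe (Fin n₂) × Maybe (Fin n₃) × Maybe (Fin n₄)

  support : Code → Support
  support (m₁ , m₂ , m₃ , m₄) = is-just m₁ , is-just m₂ , is-just m₃ , is-just m₄

  -- ∏_{i ∈ S} nᵢ, with the factors of absent coordinates omitted rather than replaced by 1, so that
  -- two weights compare factor by factor.
  weight : Support → ℕ
  weight (s₁ , s₂ , s₃ , s₄) = scale s₁ n₁ (scale s₂ n₂ (scale s₃ n₃ (scale s₄ n₄ 1)))

  triangle-max : ℕ
  triangle-max = (n₁ + n₁ * n₄) ⊔ (n₂ * n₃ + n₂ * n₃ * n₄) ⊔ (n₁ * n₄ + n₂ * n₃ * n₄)

  α : ℕ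
  α = n₁ * (n₂ * n₃ + n₂ * n₄ + n₃ * n₄ + n₂ + n₃) + triangle-max

  block : Support → List Code
  block (s₁ , s₂ , s₃ , s₄) =
    cartesianProduct (options n₁ s₁) (cartesianProduct (options n₂ s₂) (cartesianProduct (options n₃ s₃) (options n₄ s₄)))

  length-block : ∀ S → length (block S) ≡ weight S
  length-block (s₁ , s₂ , s₃ , s₄) =
    trans (length-options-× n₁ s₁ _) (cong (scale s₁ n₁)
      (trans (length-options-× n₂ s₂ _) (cong (scale s₂ n₂)
        (trans (length-options-× n₃ s₃ _) (cong (scale s₃ n₃) (length-options n₄ s₄))))))

  block-unique : ∀ S → Unique (block S)
  block-unique (s₁ , s₂ , s₃ , s₄) =
    Unique.cartesianProduct⁺ (options-unique n₁ s₁) (Unique.cartesianProduct⁺ (options-unique n₂ s₂)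
      (Unique.cartesianProduct⁺ (options-unique n₃ s₃) (options-unique n₄ s₄)))

  ∈-block : ∀ c → c ∈ block (support c)
  ∈-block (m₁ , m₂ , m₃ , m₄) =
    ∈-cartesianProduct⁺ (∈-options m₁) (∈-cartesianProduct⁺ (∈-options m₂)
      (∈-cartesianProduct⁺ (∈-options m₃) (∈-options m₄)))

  ∈-block⁻ : ∀ {c} S → c ∈ block S → support c ≡ S
  ∈-block⁻ (s₁ , s₂ , s₃ , s₄) c∈
    with m₁∈ , c∈′  ← ∈-cartesianProduct⁻ (options n₁ s₁) _ c∈
    with m₂∈ , c∈′′ ← ∈-cartesianProduct⁻ (options n₂ s₂) _ c∈′
    with m₃∈ , m₄∈  ← ∈-cartesianProduct⁻ (options n₃ s₃) (options n₄ s₄) c∈′′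
    = ,-cong₄ (∈-options⁻ s₁ m₁∈) (∈-options⁻ s₂ m₂∈) (∈-options⁻ s₃ m₃∈) (∈-options⁻ s₄ m₄∈)

  sum-weight-core : sum (map weight core) ≡ n₁ * (n₂ * n₃ + n₂ * n₄ + n₃ * n₄ + n₂ + n₃)
  sum-weight-core = normalise n₁ n₂ n₃ n₄
    where
    normalise : ∀ n₁ n₂ n₃ n₄ →
      n₁ * (n₃ * 1) + (n₁ * (n₃ * (n₄ * 1)) + (n₁ * (n₂ * 1) + (n₁ * (n₂ * (n₄ * 1)) + (n₁ * (n₂ * (n₃ * 1)) + 0))))
      ≡ n₁ * (n₂ * n₃ + n₂ * n₄ + n₃ * n₄ + n₂ + n₃)
    normalise = solve-∀

  total≤α : 1 ≤ n₄ → n₁ ≥ n₂ → n₂ ≥ n₃ → n₃ ≥ n₄ → (a : Support → ℕ) →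
            a full ≡ 0 → (∀ S → a S ≤ weight S) → (∀ S T → meets S T ≡ false → a S ≡ 0 ⊎ a T ≡ 0) →
            total a ≤ α
  total≤α 1≤n₄ n₂≤n₁ n₃≤n₂ n₄≤n₃ a a-full bound exclusive = begin
    total a                                                         ≡⟨ +-assoc (a S₁ + a S₂₃₄) (a S₁₄ + a S₂₃) _ ⟨
    a S₁ + a S₂₃₄ + (a S₁₄ + a S₂₃) + sum (map pair (core ++ [ full ])) ≤⟨ +-mono-≤ triangle core-pairs ⟩
    triangle-max + sum (map weight core)                            ≡⟨ cong (triangle-max +_) sum-weight-core ⟩
    triangle-max + n₁ * (n₂ * n₃ + n₂ * n₄ + n₃ * n₄ + n₂ + n₃)     ≡⟨ +-comm triangle-max _ ⟩
    α                                                               ∎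
    where
    open ≤-Reasoning
    S₁ S₂₃₄ S₁₄ S₂₃ : Support
    S₁   = true , false , false , false
    S₂₃₄ = false , true , true , true
    S₁₄  = true , false , false , true
    S₂₃  = false , true , true , false

    n₃≤n₁ : n₃ ≤ n₁
    n₃≤n₁ = ≤-trans n₃≤n₂ n₂≤n₁
    n₄≤n₂ : n₄ ≤ n₂
    n₄≤n₂ = ≤-trans n₄≤n₃ n₃≤n₂
    n₄≤n₁ : n₄ ≤ n₁
    n₄≤n₁ = ≤-trans n₄≤n₂ n₂≤n₁
    1≤n₃ : 1 ≤ n₃
    1≤n₃ = ≤-trans 1≤n₄ n₄≤n₃
    1≤n₂ : 1 ≤ n₂
    1≤n₂ = ≤-trans 1≤n₃ n₃≤n₂
    1≤n₃n₄ : 1 ≤ n₃ * (n₄ * 1)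
    1≤n₃n₄ = *-mono-≤ 1≤n₃ (*-mono-≤ 1≤n₄ ≤-refl)
    1≤n₂n₄ : 1 ≤ n₂ * (n₄ * 1)
    1≤n₂n₄ = *-mono-≤ 1≤n₂ (*-mono-≤ 1≤n₄ ≤-refl)
    1≤n₂n₃ : 1 ≤ n₂ * (n₃ * 1)
    1≤n₂n₃ = *-mono-≤ 1≤n₂ (*-mono-≤ 1≤n₃ ≤-refl)

    pair : Support → ℕ
    pair S = a S + a (∁ S)

    pair≤weight : ∀ S → weight (∁ S) ≤ weight S → pair S ≤ weight S
    pair≤weight S w∁S≤wS = +-≤-if-one-zero (bound S) (≤-trans (bound (∁ S)) w∁S≤wS) (exclusive S (∁ S) (meets-∁ S))

    core-pairs : sum (map pair (core ++ [ full ])) ≤ sum (map weight core)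
    core-pairs =
      +-mono-≤ (pair≤weight (true , false , true , false) (*-mono-≤ n₂≤n₁ (*-mono-≤ n₄≤n₃ ≤-refl))) (
      +-mono-≤ (pair≤weight (true , false , true , true)  (*-mono-≤ n₂≤n₁ 1≤n₃n₄)) (
      +-mono-≤ (pair≤weight (true , true , false , false) (*-mono-≤ n₃≤n₁ (*-mono-≤ n₄≤n₂ ≤-refl))) (
      +-mono-≤ (pair≤weight (true , true , false , true)  (*-mono-≤ n₃≤n₁ 1≤n₂n₄)) (
      +-mono-≤ (pair≤weight (true , true , true , false)  (*-mono-≤ n₄≤n₁ 1≤n₂n₃))
               (≤-reflexive (cong₂ _+_ (cong₂ _+_ a-full (reduce (exclusive _ _ refl))) refl))))))

    triangle : a S₁ + a S₂₃₄ + (a S₁₄ + a S₂₃) ≤ triangle-max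
    triangle = +-≤-triangle
      (≤-trans (bound S₁) (≤-reflexive (*-identityʳ n₁)))
      (≤-trans (bound S₂₃₄)
               (≤-reflexive (trans (cong (λ k → n₂ * (n₃ * k)) (*-identityʳ n₄)) (sym (*-assoc n₂ n₃ n₄)))))
      (≤-trans (bound S₁₄) (≤-reflexive (cong (n₁ *_) (*-identityʳ n₄))))
      (≤-trans (bound S₂₃) (≤-reflexive (cong (n₂ *_) (*-identityʳ n₃))))
      (exclusive S₁ S₂₃₄ refl) (exclusive S₁₄ S₂₃ refl) (exclusive S₁ S₂₃ refl)

  -- With c = d, meet says that every support is nonempty.
  record IsIntersecting (cs : List Code) : Set where
    field
      distinct : Unique cs
      meet     : ∀ {c d} → c ∈ cs → d ∈ cs → meets (support c) (support d) ≡ true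
      proper   : All (λ c → support c ≢ full) cs

  count : Support → List Code → ℕ
  count S cs = length (filter (λ c → support c ≟ˢ S) cs)

  count≡0⊎∈ : ∀ S cs → count S cs ≡ 0 ⊎ ∃ λ c → c ∈ cs × support c ≡ S
  count≡0⊎∈ S cs with filter (λ c → support c ≟ˢ S) cs in eq
  ... | []    = inj₁ refl
  ... | c ∷ _ = inj₂ (c , ∈-filter⁻ (λ c → support c ≟ˢ S) (subst (c ∈_) (sym eq) (here refl)))

  count≤weight : ∀ S {cs} → Unique cs → count S cs ≤ weight S
  count≤weight S {cs} unique = subst (count S cs ≤_) (length-block S)
    (Unique-⊆⇒length≤ (Unique.filter⁺ _ unique) λ c∈ →
      subst (λ T → _ ∈ block T) (proj₂ (∈-filter⁻ (λ c → support c ≟ˢ S) {xs = cs} c∈)) (∈-block _))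

  length≤total-count : ∀ {cs} → Unique cs → length cs ≤ total (λ S → count S cs)
  length≤total-count {cs} unique = ≤-trans (Unique-⊆⇒length≤ unique covered) (≤-reflexive (begin
    length (concatMap pair-class halfSupports)   ≡⟨ length-concatMap pair-class halfSupports ⟩
    sum (map (length ∘ pair-class) halfSupports) ≡⟨ cong sum (map-cong (λ S → length-++ (class S) {class (∁ S)}) halfSupports) ⟩
    total (λ S → count S cs)                     ∎))
    where
    open ≡-Reasoning
    class pair-class : Support → List Code
    class S = filter (λ c → support c ≟ˢ S) cs
    pair-class S = class S ++ class (∁ S)

    covered : cs ⊆ concatMap pair-class halfSupports
    covered {c} c∈ with ∈-halfSupports (support c)
    ... | inj₁ S∈  = ∈-concatMap⁺ pair-class (lose S∈ (∈-++⁺ˡ (∈-filter⁺ (λ d → support d ≟ˢ support c) c∈ refl)))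
    ... | inj₂ ∁S∈ = ∈-concatMap⁺ pair-class
      (lose ∁S∈ (∈-++⁺ʳ (class _) (∈-filter⁺ (λ d → support d ≟ˢ ∁ (∁ (support c))) c∈ (sym (∁-involutive _)))))

  module _ {cs} (I : IsIntersecting cs) where
    open IsIntersecting I

    count-full : count full cs ≡ 0
    count-full with count≡0⊎∈ full cs
    ... | inj₁ none             = none
    ... | inj₂ (c , c∈ , c-full) = ⊥-elim (All.lookup proper c∈ c-full)

    count-exclusive : ∀ S T → meets S T ≡ false → count S cs ≡ 0 ⊎ count T cs ≡ 0
    count-exclusive S T disjoint with count≡0⊎∈ S cs | count≡0⊎∈ T cs
    ... | inj₁ none | _         = inj₁ none
    ... | _         | inj₁ none = inj₂ none
    ... | inj₂ (c , c∈ , refl) | inj₂ (d , d∈ , refl) with () ← trans (sym (meet c∈ d∈)) disjoint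

    length≤α : 1 ≤ n₄ → n₁ ≥ n₂ → n₂ ≥ n₃ → n₃ ≥ n₄ → length cs ≤ α
    length≤α 1≤n₄ n₂≤n₁ n₃≤n₂ n₄≤n₃ = ≤-trans (length≤total-count distinct)
      (total≤α 1≤n₄ n₂≤n₁ n₃≤n₂ n₄≤n₃ (λ S → count S cs)
               count-full (λ S → count≤weight S distinct) count-exclusive)

  blocks : List Support → List Code
  blocks = concatMap block

  ∈-blocks⁻ : ∀ {c 𝓕} → c ∈ blocks 𝓕 → support c ∈ 𝓕
  ∈-blocks⁻ = Any.map (∈-block⁻ _) ∘ ∈-concatMap⁻ block

  length-blocks : ∀ 𝓕 → length (blocks 𝓕) ≡ sum (map weight 𝓕)
  length-blocks 𝓕 = trans (length-concatMap block 𝓕) (cong sum (map-cong length-block 𝓕))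

  blocks-intersecting : ∀ {𝓕} → IsIntersectingFamily 𝓕 → IsIntersecting (blocks 𝓕)
  blocks-intersecting (unique , meet , proper) = record
    { distinct = Unique.concat⁺ (All.map⁺ (All.universal block-unique _)) (AllPairs.map⁺ (AllPairs.map disjoint unique))
    ; meet     = λ c∈ d∈ → All.lookup (All.lookup meet (∈-blocks⁻ c∈)) (∈-blocks⁻ d∈)
    ; proper   = All.tabulate (All.lookup proper ∘ ∈-blocks⁻)
    }
    where
    disjoint : ∀ {S T} → S ≢ T → Disjoint (block S) (block T)
    disjoint S≢T (c∈S , c∈T) = S≢T (trans (sym (∈-block⁻ _ c∈S)) (∈-block⁻ _ c∈T))

  attained : ∃ λ cs → IsIntersecting cs × length cs ≡ α
  attained = choose (⊔-sel (X ⊔ Y) Z) (⊔-sel X Y)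
    where
    X Y Z : ℕ
    X = n₁ + n₁ * n₄
    Y = n₂ * n₃ + n₂ * n₃ * n₄
    Z = n₁ * n₄ + n₂ * n₃ * n₄

    from-family : ∀ extra {_ : True (isIntersectingFamily? (core ++ extra))} →
                  triangle-max ≡ sum (map weight extra) → ∃ λ cs → IsIntersecting cs × length cs ≡ α
    from-family extra {checked} max≡ =
      blocks (core ++ extra) ,
      blocks-intersecting (toWitness checked) ,
      trans (length-blocks (core ++ extra)) (trans (sum-++ (map weight core) (map weight extra)) (cong₂ _+_ sum-weight-core (sym max≡)))

    X-weights : ∀ n₁ n₄ → n₁ + n₁ * n₄ ≡ n₁ * 1 + (n₁ * (n₄ * 1) + 0)
    X-weights = solve-∀
    Y-weights : ∀ n₂ n₃ n₄ → n₂ * n₃ + n₂ * n₃ * n₄ ≡ n₂ * (n₃ * 1) + (n₂ * (n₃ * (n₄ * 1)) + 0)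
    Y-weights = solve-∀
    Z-weights : ∀ n₁ n₂ n₃ n₄ → n₁ * n₄ + n₂ * n₃ * n₄ ≡ n₁ * (n₄ * 1) + (n₂ * (n₃ * (n₄ * 1)) + 0)
    Z-weights = solve-∀

    choose : triangle-max ≡ X ⊔ Y ⊎ triangle-max ≡ Z → X ⊔ Y ≡ X ⊎ X ⊔ Y ≡ Y →
             ∃ λ cs → IsIntersecting cs × length cs ≡ α
    choose (inj₂ max≡Z) _ =
      from-family ((true , false , false , true) ∷ (false , true , true , true) ∷ [])
                  (trans max≡Z (Z-weights n₁ n₂ n₃ n₄))
    choose (inj₁ max≡X⊔Y) (inj₁ X⊔Y≡X) =
      from-family ((true , false , false , false) ∷ (true , false , false , true) ∷ [])
                  (trans max≡X⊔Y (trans X⊔Y≡X (X-weights n₁ n₄)))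
    choose (inj₁ max≡X⊔Y) (inj₂ X⊔Y≡Y) =
      from-family ((false , true , true , false) ∷ (false , true , true , true) ∷ [])
                  (trans max≡X⊔Y (trans X⊔Y≡Y (Y-weights n₂ n₃ n₄)))

-- Finite fields and their product

punchOutᵐ : ∀ {n} → Fin (suc n) → Fin (suc n) → Maybe (Fin n)
punchOutᵐ i j with i ≟ j
... | yes _   = nothing
... | no  i≢j = just (punchOut i≢j)

punchInᵐ : ∀ {n} → Fin (suc n) → Maybe (Fin n) → Fin (suc n)
punchInᵐ i nothing  = i
punchInᵐ i (just j) = punchIn i j

punchOutᵐ-injective : ∀ {n} (i : Fin (suc n)) {j k} → punchOutᵐ i j ≡ punchOutᵐ i k → j ≡ k
punchOutᵐ-injective i {j} {k} eq with i ≟ j | i ≟ k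
... | yes refl | yes refl = refl
... | no  i≢j  | no  i≢k  = punchOut-injective i≢j i≢k (just-injective eq)

punchOutᵐ-punchInᵐ : ∀ {n} (i : Fin (suc n)) m → punchOutᵐ i (punchInᵐ i m) ≡ m
punchOutᵐ-punchInᵐ i nothing with i ≟ i
... | yes _   = refl
... | no  i≢i = contradiction refl i≢i
punchOutᵐ-punchInᵐ i (just j) with i ≟ punchIn i j
... | yes i≡ = contradiction (sym i≡) (punchInᵢ≢i i j)
... | no  i≢ = cong just (trans (punchOut-cong i refl) (punchOut-punchIn i))

-- code identifies F with Maybe (Fin n) up to ≈, with 0# ↦ nothing.
module FieldCode {c ℓ} (F : FiniteIntegralDomain c ℓ) {n : ℕ} (card≡ : FiniteIntegralDomain.card F ≡ suc n) where
  open FiniteIntegralDomain F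
  open CommutativeRing ring
    using (Carrier; _≈_; 0#; 1#; zeroˡ; zeroʳ; *-congˡ; *-congʳ)
    renaming (_*_ to _·_; sym to ≈-sym; trans to ≈-trans; reflexive to ≈-reflexive)

  private
    index : Carrier → Fin (suc n)
    index x = subst Fin card≡ (proj₁ (enum-surj x))

    element : Fin (suc n) → Carrier
    element i = enum (subst Fin (sym card≡) i)

    index-cong : ∀ {x y} → x ≈ y → index x ≡ index y
    index-cong {x} {y} x≈y with i , eᵢ≈x ← enum-surj x | j , eⱼ≈y ← enum-surj y =
      cong (subst Fin card≡) (enum-inj i j (≈-trans eᵢ≈x (≈-trans x≈y (≈-sym eⱼ≈y))))

    index-injective : ∀ {x y} → index x ≡ index y → x ≈ y
    index-injective {x} {y} eq with i , eᵢ≈x ← enum-surj x | j , eⱼ≈y ← enum-surj y =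
      ≈-trans (≈-sym eᵢ≈x) (≈-trans (≈-reflexive (cong enum (subst-injective card≡ eq))) eⱼ≈y)

    index-element : ∀ i → index (element i) ≡ i
    index-element i with j , eⱼ≈ ← enum-surj (element i) =
      trans (cong (subst Fin card≡) (enum-inj _ _ eⱼ≈)) (subst-subst-sym card≡)

  code : Carrier → Maybe (Fin n)
  code x = punchOutᵐ (index 0#) (index x)

  decode : Maybe (Fin n) → Carrier
  decode m = element (punchInᵐ (index 0#) m)

  code-cong : ∀ {x y} → x ≈ y → code x ≡ code y
  code-cong = cong (punchOutᵐ (index 0#)) ∘ index-cong

  code-injective : ∀ {x y} → code x ≡ code y → x ≈ y
  code-injective = index-injective ∘ punchOutᵐ-injective (index 0#)

  code-decode : ∀ m → code (decode m) ≡ m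
  code-decode m = trans (cong (punchOutᵐ (index 0#)) (index-element _)) (punchOutᵐ-punchInᵐ (index 0#) m)

  code-0# : code 0# ≡ nothing
  code-0# = punchOutᵐ-punchInᵐ (index 0#) nothing

  1≤n : 1 ≤ n
  1≤n with code 1# in eq
  ... | nothing = ⊥-elim (nontrivial (code-injective (trans eq (sym code-0#))))
  ... | just j  = >-nonZero⁻¹ n {{nonZeroIndex j}}

  is-just≡false⇒≈0 : ∀ {x} → is-just (code x) ≡ false → x ≈ 0#
  is-just≡false⇒≈0 {x} _ with code x in eq
  ... | nothing = code-injective (trans eq (sym code-0#))

  is-just≡true⇒≉0 : ∀ {x} → is-just (code x) ≡ true → ¬ x ≈ 0#
  is-just≡true⇒≉0 j x≈0 with () ← trans (sym j) (cong is-just (trans (code-cong x≈0) code-0#))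

  *-≈0 : ∀ x y → is-just (code x) ∧ is-just (code y) ≡ false → x · y ≈ 0#
  *-≈0 x y disjoint with is-just (code x) in jx
  ... | false = ≈-trans (*-congʳ (is-just≡false⇒≈0 jx)) (zeroˡ y)
  ... | true  = ≈-trans (*-congˡ (is-just≡false⇒≈0 disjoint)) (zeroʳ x)

  *-≉0 : ∀ x y → is-just (code x) ∧ is-just (code y) ≡ true → ¬ x · y ≈ 0#
  *-≉0 x y both xy≈0 with noZeroDivisors x y xy≈0
  ... | inj₁ x≈0 = is-just≡true⇒≉0 (Bool.∧-conicalˡ _ _ both) x≈0
  ... | inj₂ y≈0 = is-just≡true⇒≉0 (Bool.∧-conicalʳ _ _ both) y≈0

  *-cancelˡ : ∀ x y → is-just (code x) ≡ true → x · y ≈ 0# → y ≈ 0#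
  *-cancelˡ x y j xy≈0 with noZeroDivisors x y xy≈0
  ... | inj₁ x≈0 = contradiction x≈0 (is-just≡true⇒≉0 j)
  ... | inj₂ y≈0 = y≈0

  x*x≈0⇒x≈0 : ∀ x → x · x ≈ 0# → x ≈ 0#
  x*x≈0⇒x≈0 x xx≈0 = reduce (noZeroDivisors x x xx≈0)

  annihilator : Carrier → Carrier
  annihilator x = if is-just (code x) then 0# else 1#

  *-annihilator : ∀ x → x · annihilator x ≈ 0#
  *-annihilator x with is-just (code x) in jx
  ... | true  = zeroʳ x
  ... | false = ≈-trans (*-congʳ (is-just≡false⇒≈0 jx)) (zeroˡ 1#)

  annihilator≈0⇒just : ∀ x → annihilator x ≈ 0# → is-just (code x) ≡ true
  annihilator≈0⇒just x a≈0 with is-just (code x)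
  ... | true  = refl
  ... | false = contradiction a≈0 nontrivial

module ProductCode {c ℓ} (F₁ F₂ F₃ F₄ : FiniteIntegralDomain c ℓ) {n₁ n₂ n₃ n₄ : ℕ}
  (card₁ : FiniteIntegralDomain.card F₁ ≡ suc n₁) (card₂ : FiniteIntegralDomain.card F₂ ≡ suc n₂)
  (card₃ : FiniteIntegralDomain.card F₃ ≡ suc n₃) (card₄ : FiniteIntegralDomain.card F₄ ≡ suc n₄) where

  private
    module K₁ = FieldCode F₁ card₁
    module K₂ = FieldCode F₂ card₂
    module K₃ = FieldCode F₃ card₃
    module K₄ = FieldCode F₄ card₄
    R = product4 F₁ F₂ F₃ F₄

  open CommutativeRing R using (Carrier; _≈_; 0#) renaming (_*_ to _·_; trans to ≈-trans; *-congʳ to ·-congʳ; zeroˡ to ·-zeroˡ)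
  open ZeroDivisorGraph R
  open Codes n₁ n₂ n₃ n₄ using (Code; support; IsIntersecting)

  code : Carrier → Code
  code (x₁ , x₂ , x₃ , x₄) = K₁.code x₁ , K₂.code x₂ , K₃.code x₃ , K₄.code x₄

  decode : Code → Carrier
  decode (m₁ , m₂ , m₃ , m₄) = K₁.decode m₁ , K₂.decode m₂ , K₃.decode m₃ , K₄.decode m₄

  code-cong : ∀ {x y} → x ≈ y → code x ≡ code y
  code-cong (e₁ , e₂ , e₃ , e₄) = ,-cong₄ (K₁.code-cong e₁) (K₂.code-cong e₂) (K₃.code-cong e₃) (K₄.code-cong e₄)

  code-injective : ∀ {x y} → code x ≡ code y → x ≈ y
  code-injective eq =
    K₁.code-injective (cong proj₁ eq) , K₂.code-injective (cong (proj₁ ∘ proj₂) eq) ,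
    K₃.code-injective (cong (proj₁ ∘ proj₂ ∘ proj₂) eq) , K₄.code-injective (cong (proj₂ ∘ proj₂ ∘ proj₂) eq)

  code-decode : ∀ c → code (decode c) ≡ c
  code-decode (m₁ , m₂ , m₃ , m₄) = ,-cong₄ (K₁.code-decode m₁) (K₂.code-decode m₂) (K₃.code-decode m₃) (K₄.code-decode m₄)

  supp : Carrier → Support
  supp = support ∘ code

  *-≈0-if-disjoint : ∀ x y → meets (supp x) (supp y) ≡ false → x · y ≈ 0#
  *-≈0-if-disjoint x@(x₁ , x₂ , x₃ , x₄) y@(y₁ , y₂ , y₃ , y₄) disjoint
    with d₁ , d₂ , d₃ , d₄ ← meets≡false⇒ (supp x) (supp y) disjoint =
    K₁.*-≈0 x₁ y₁ d₁ , K₂.*-≈0 x₂ y₂ d₂ , K₃.*-≈0 x₃ y₃ d₃ , K₄.*-≈0 x₄ y₄ d₄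

  *-≉0-if-meets : ∀ x y → meets (supp x) (supp y) ≡ true → ¬ x · y ≈ 0#
  *-≉0-if-meets x@(x₁ , x₂ , x₃ , x₄) y@(y₁ , y₂ , y₃ , y₄) meet (e₁ , e₂ , e₃ , e₄)
    with meets≡true⇒ (supp x) (supp y) meet
  ... | inj₁ m₁               = K₁.*-≉0 x₁ y₁ m₁ e₁
  ... | inj₂ (inj₁ m₂)        = K₂.*-≉0 x₂ y₂ m₂ e₂
  ... | inj₂ (inj₂ (inj₁ m₃)) = K₃.*-≉0 x₃ y₃ m₃ e₃
  ... | inj₂ (inj₂ (inj₂ m₄)) = K₄.*-≉0 x₄ y₄ m₄ e₄

  ≈0-if-disjoint-from-itself : ∀ x → meets (supp x) (supp x) ≡ false → x ≈ 0#
  ≈0-if-disjoint-from-itself x@(x₁ , x₂ , x₃ , x₄) disjoint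
    with e₁ , e₂ , e₃ , e₄ ← *-≈0-if-disjoint x x disjoint =
    K₁.x*x≈0⇒x≈0 x₁ e₁ , K₂.x*x≈0⇒x≈0 x₂ e₂ , K₃.x*x≈0⇒x≈0 x₃ e₃ , K₄.x*x≈0⇒x≈0 x₄ e₄

  *-cancel-if-full : ∀ x y → supp x ≡ full → x · y ≈ 0# → y ≈ 0#
  *-cancel-if-full (x₁ , x₂ , x₃ , x₄) (y₁ , y₂ , y₃ , y₄) full (e₁ , e₂ , e₃ , e₄) =
    K₁.*-cancelˡ x₁ y₁ (cong proj₁ full) e₁ ,
    K₂.*-cancelˡ x₂ y₂ (cong (proj₁ ∘ proj₂) full) e₂ ,
    K₃.*-cancelˡ x₃ y₃ (cong (proj₁ ∘ proj₂ ∘ proj₂) full) e₃ ,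
    K₄.*-cancelˡ x₄ y₄ (cong (proj₂ ∘ proj₂ ∘ proj₂) full) e₄

  annihilated-if-not-full : ∀ x → supp x ≢ full → ∃ λ y → ¬ y ≈ 0# × x · y ≈ 0#
  annihilated-if-not-full (x₁ , x₂ , x₃ , x₄) not-full =
    (K₁.annihilator x₁ , K₂.annihilator x₂ , K₃.annihilator x₃ , K₄.annihilator x₄) ,
    (λ (a₁ , a₂ , a₃ , a₄) → not-full (,-cong₄ (K₁.annihilator≈0⇒just x₁ a₁) (K₂.annihilator≈0⇒just x₂ a₂)
                                                (K₃.annihilator≈0⇒just x₃ a₃) (K₄.annihilator≈0⇒just x₄ a₄))) ,
    (K₁.*-annihilator x₁ , K₂.*-annihilator x₂ , K₃.*-annihilator x₃ , K₄.*-annihilator x₄)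

  vertex⇒proper-support : ∀ {x} → IsVertex x → meets (supp x) (supp x) ≡ true × supp x ≢ full
  vertex⇒proper-support {x} (x≉0 , y , y≉0 , xy≈0) =
    Bool.¬-not (x≉0 ∘ ≈0-if-disjoint-from-itself x) , λ full → y≉0 (*-cancel-if-full x y full xy≈0)

  proper-support⇒vertex : ∀ {x} → meets (supp x) (supp x) ≡ true → supp x ≢ full → IsVertex x
  proper-support⇒vertex {x} meet not-full =
    (λ x≈0 → *-≉0-if-meets x x meet (≈-trans (·-congʳ x≈0) (·-zeroˡ x))) , annihilated-if-not-full x not-full

  ¬adjacent⇒meets : ∀ {x y} → ¬ x ≈ y → ¬ Adjacent x y → meets (supp x) (supp y) ≡ true
  ¬adjacent⇒meets {x} {y} x≉y ¬adj = Bool.¬-not (λ disjoint → ¬adj (x≉y , *-≈0-if-disjoint x y disjoint))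

  independent⇒intersecting : ∀ {xs} → IsIndependent xs → IsIntersecting (map code xs)
  independent⇒intersecting {xs} (vertices , distinct , nonadjacent) = record
    { distinct = AllPairs.map⁺ (AllPairs.map (λ x≉y → x≉y ∘ code-injective) distinct)
    ; meet     = meet
    ; proper   = All.map⁺ (All.map (proj₂ ∘ vertex⇒proper-support) vertices)
    }
    where
    meet : ∀ {c d} → c ∈ map code xs → d ∈ map code xs → meets (support c) (support d) ≡ true
    meet c∈ d∈ with x , x∈ , refl ← ∈-map⁻ code c∈ | y , y∈ , refl ← ∈-map⁻ code d∈ =
      AllPairs⇒∈-related (λ {x} {y} m → trans (meets-sym (supp y) (supp x)) m)
        (All.map (proj₁ ∘ vertex⇒proper-support) vertices)
        (AllPairs.zipWith (λ (x≉y , ¬adj) → ¬adjacent⇒meets x≉y ¬adj) (distinct , nonadjacent)) x∈ y∈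

  intersecting⇒independent : ∀ {xs} → IsIntersecting (map code xs) → IsIndependent xs
  intersecting⇒independent {xs} I =
    All.tabulate (λ x∈ → proper-support⇒vertex (meet (∈-map⁺ code x∈) (∈-map⁺ code x∈)) (All.lookup (All.map⁻ proper) x∈)) ,
    AllPairs.map (λ cx≢cy → cx≢cy ∘ code-cong) (AllPairs.map⁻ distinct) ,
    ∈-related⇒AllPairs (λ {x} {y} x∈ y∈ (_ , xy≈0) → *-≉0-if-meets x y (meet (∈-map⁺ code x∈) (∈-map⁺ code y∈)) xy≈0)
    where open IsIntersecting I

  decode-independent : ∀ {cs} → IsIntersecting cs → IsIndependent (map decode cs)
  decode-independent {cs} I = intersecting⇒independent (subst IsIntersecting (sym code∘decode) I)
    where
    code∘decode : map code (map decode cs) ≡ cs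
    code∘decode = trans (sym (map-∘ cs)) (trans (map-cong code-decode cs) (map-id cs))

corollary11 : ∀ {c ℓ} (F₁ F₂ F₃ F₄ : FiniteIntegralDomain c ℓ) (n₁ n₂ n₃ n₄ : ℕ) →
    FiniteIntegralDomain.card F₁ ≡ suc n₁ →
    FiniteIntegralDomain.card F₂ ≡ suc n₂ →
    FiniteIntegralDomain.card F₃ ≡ suc n₃ →
    FiniteIntegralDomain.card F₄ ≡ suc n₄ →
    n₁ ≥ n₂ → n₂ ≥ n₃ → n₃ ≥ n₄ →
    ZeroDivisorGraph.IsIndependenceNumber (product4 F₁ F₂ F₃ F₄)
      (n₁ * (n₂ * n₃ + n₂ * n₄ + n₃ * n₄ + n₂ + n₃)
        + ((n₁ + n₁ * n₄) ⊔ (n₂ * n₃ + n₂ * n₃ * n₄) ⊔ (n₁ * n₄ + n₂ * n₃ * n₄)))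
corollary11 F₁ F₂ F₃ F₄ n₁ n₂ n₃ n₄ card₁ card₂ card₃ card₄ n₂≤n₁ n₃≤n₂ n₄≤n₃ = maximum , upper-bound
  where
  open Codes n₁ n₂ n₃ n₄ using (α; attained; length≤α)
  open ProductCode F₁ F₂ F₃ F₄ card₁ card₂ card₃ card₄
  open ZeroDivisorGraph (product4 F₁ F₂ F₃ F₄) using (IsIndependent)

  maximum : ∃ λ xs → IsIndependent xs × length xs ≡ α
  maximum with cs , I , length≡α ← attained = map decode cs , decode-independent I , trans (length-map decode cs) length≡α

  upper-bound : ∀ xs → IsIndependent xs → length xs ≤ α
  upper-bound xs independent = subst (_≤ α) (length-map code xs)
    (length≤α (independent⇒intersecting independent) (FieldCode.1≤n F₄ card₄) n₂≤n₁ n₃≤n₂ n₄≤n₃)
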